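{- Let $\Gamma$ be a type context, let $e$ be an expression whose only free variables are signal names, let $\rho$ be a type, and let $v$ be a value. If $\Gamma \vdash e:\rho$ is derivable and $e \Downarrow v$, then $\Gamma \vdash v:\rho$ is derivable.
   Context: Syntax. Signal names $s,t,\ldots$ are among the variables. Constructors $\mathsf{c}$ (e.g. $\mathsf{*},\mathsf{nil},\mathsf{cons}$) and first-order function symbols $f$ are given. Values are terms built from signal names and constructors; expressions are terms built from variables, constructors and function symbols. There is an evaluation relation $\Downarrow$ such that for every function symbol $f$ and values $v_1,\ldots,v_n$ of suitable type there is a unique value $v$ with $f(v_1,\ldots,v_n)\Downarrow v$; it is extended in the standard (call-by-value, structural) way to expressions whose only free variables are signal names: a value evaluates to itself, $\mathsf{c}(e_1,\ldots,e_n)\Downarrow \mathsf{c}(v_1,\ldots,v_n)$ and $f(e_1,\ldots,e_n)\Downarrow v$ when $e_i\Downarrow v_i$ and $f(v_1,\ldots,v_n)\Downarrow v$. Usages. Let $L=\{0,1,\infty\}$ with partial addition $0\oplus a=a\oplus 0=a$, $\infty\oplus\infty=\infty$, undefined otherwise, and order $a\le b$ iff $a\oplus c=b$ for some $c$. Five main usages in $L^3$: $e_1=(\infty,0,\infty)$, $e_2=(1,\infty,\infty)$, $e_3=(\infty,0,1)$, $e_4=(1,0,1)$, $e_5=(1,1,0)$, with derived usages: none for $e_1$; $(0,\infty,\infty)$ for $e_2$; $(\infty,0,0)$ for $e_3$; $(1,0,0),(0,0,1),(0,0,0)$ for $e_4$; $(1,0,0),(0,1,0),(0,0,0)$ for $e_5$.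 A signal usage of kind $i$ is an infinite word $xy^\omega$ where $x,y$ are each $e_i$ or one of its derived usages; $U(i)$ is the set of them. Addition of signal usages is componentwise (via $\oplus$ on $L$), defined only if both lie in some $U(i)$ and the result lies in $U(i)$; $u\ge u'$ iff $u=u'\oplus w$ for some $w$. A usage is affine if it contains a $1$, uniform if of shape $x^\omega$, neutral if it is the neutral element of addition in its $U(i)$; usages of kinds 3,4,5 are affine-preserving. Inductive types and set types carry a usage $x\in\{1,\infty\}$ (added as in $L$; $1$ is affine/affine-preserving). Types. Inductive types $C_x(\sigma_1,\ldots,\sigma_k)$ are declared by constructor equations (e.g. $\mathit{List}_x(\sigma)=\mathsf{nil}\mid \mathsf{cons}\ \mathit{of}\ \sigma,\mathit{List}_x(\sigma)$); set types $\mathit{Set}_x(\sigma)$ are declared like lists; $\mathit{Sig}_u(\sigma)$ is the type of signals carrying values of type $\sigma$ with signal usage $u$. The admissible types are: $\kappa ::= C_\infty(\vec\kappa)\mid \mathit{Set}_\infty(\kappa)\mid \mathit{Sig}_u(\kappa)$ ($u$ neutral); $\lambda ::= C_1(\vec\sigma)\mid \mathit{Set}_1(\sigma)\mid \mathit{Sig}_u(\kappa)\mid \mathit{Sig}_v(\lambda)$ ($u$ affine and uniform, $v$ affine-preserving and uniform); $\sigma::=\kappa\mid\lambda$; $\rho::=\sigma\mid \mathit{Sig}_u(\kappa)\mid\mathit{Sig}_v(\lambda)$ ($v$ affine-preserving). Each constructor $\mathsf{c}$ has a declared type $(\sigma_1,\ldots,\sigma_n)\to\sigma$, and each function symbol $f$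 has a declared non-affine type $(\kappa_1,\ldots,\kappa_n)\to\kappa$. Addition of types: $\mathit{Op}_{u_1}(\vec\sigma)\oplus\mathit{Op}_{u_2}(\vec\sigma)=\mathit{Op}_{u_1\oplus u_2}(\vec\sigma)$ for $\mathit{Op}\in\{C,\mathit{Set},\mathit{Sig}\}$ when $u_1\oplus u_2$ is defined. Contexts. A context $\Gamma$ is a finite partial function from variables to types; $\Gamma_1\oplus\Gamma_2$ is defined iff $\Gamma_1(x)\oplus\Gamma_2(x)$ is defined for every $x$ in both domains, and is then the pointwise sum (taking the available type where only one is defined). $\Gamma,x:\rho$ denotes the extension of $\Gamma$ with $x\notin\mathrm{dom}(\Gamma)$. Typing of expressions is given by exactly two rules: (var) $\Gamma, x:\mathit{Op}_u(\vec\sigma)\vdash x:\mathit{Op}_{u'}(\vec\sigma)$ whenever $u\ge u'$ and $\mathit{Op}\in\{\mathit{Sig},\mathit{Set},C\}$; (k) if $k$ is a constructor or function symbol of type $(\sigma_1,\ldots,\sigma_n)\to\sigma$ and $\Gamma_i\vdash e_i:\sigma_i$ for $i=1,\ldots,n$, then $\Gamma_0\oplus\Gamma_1\oplus\cdots\oplus\Gamma_n\vdash k(e_1,\ldots,e_n):\sigma$ for any context $\Gamma_0$ making the sum defined. Standing assumption on function symbols: for each $f:(\kappa_1,\ldots,\kappa_n)\to\kappa$, if $\Gamma\vdash f(v_1,\ldots,v_n):\kappa$ and $f(v_1,\ldots,v_n)\Downarrow v$ then $\Gamma\vdash v:\kappa$. -}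

module Defs where

open import Data.Nat using (ℕ)
open import Data.Product using (Σ; _×_; _,_; ∃)
open import Data.Sum using (_⊎_)
open import Data.Maybe using (Maybe; just; nothing)
open import Data.List using (List; []; _∷_)
open import Data.List.Membership.Propositional using (_∈_)
import Data.List.Relation.Unary.All as LAll
open import Data.Vec using (Vec)
import Data.Vec.Relation.Unary.All as VAll
open import Relation.Binary.PropositionalEquality using (_≡_)

data L : Set where
  𝟘 𝟙 ∞ : L

data _⊕ᴸ_≡_ : L → L → L → Set where
  0⊕a : ∀ {a} → 𝟘 ⊕ᴸ a ≡ a
  a⊕0 : ∀ {a} → a ⊕ᴸ 𝟘 ≡ a
  ∞⊕∞ : ∞ ⊕ᴸ ∞ ≡ ∞

_≤ᴸ_ : L → L → Set
a ≤ᴸ b = Σ L λ c → a ⊕ᴸ c ≡ b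

-- Usages of inductive and set types: x ∈ {1,∞}, added/ordered as in L

data IU : Set where
  one inf : IU

IU→L : IU → L
IU→L one = 𝟙
IU→L inf = ∞

_⊕ᴵ_≡_ : IU → IU → IU → Set
a ⊕ᴵ b ≡ c = IU→L a ⊕ᴸ IU→L b ≡ IU→L c

_≥ᴵ_ : IU → IU → Set
u ≥ᴵ u' = IU→L u' ≤ᴸ IU→L u

Triple : Set
Triple = L × L × L

data Kind : Set where
  k1 k2 k3 k4 k5 : Kind

-- InKind i t : t is the main usage e_i or one of its derived usages
data InKind : Kind → Triple → Set where
  e1      : InKind k1 (∞ , 𝟘 , ∞)
  e2      : InKind k2 (𝟙 , ∞ , ∞)
  e2-d    : InKind k2 (𝟘 , ∞ , ∞)
  e3      : InKind k3 (∞ , 𝟘 , 𝟙)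
  e3-d    : InKind k3 (∞ , 𝟘 , 𝟘)
  e4      : InKind k4 (𝟙 , 𝟘 , 𝟙)
  e4-d1   : InKind k4 (𝟙 , 𝟘 , 𝟘)
  e4-d2   : InKind k4 (𝟘 , 𝟘 , 𝟙)
  e4-d3   : InKind k4 (𝟘 , 𝟘 , 𝟘)
  e5      : InKind k5 (𝟙 , 𝟙 , 𝟘)
  e5-d1   : InKind k5 (𝟙 , 𝟘 , 𝟘)
  e5-d2   : InKind k5 (𝟘 , 𝟙 , 𝟘)
  e5-d3   : InKind k5 (𝟘 , 𝟘 , 𝟘)

-- A signal usage is the infinite word  x y^ω ; it is determined by (x , y)
record SU : Set where
  constructor _·_^ω
  field
    x y : Triple
open SU public

InU : Kind → SU → Set
InU i u = InKind i (x u) × InKind i (y u)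

_⊕³_≡_ : Triple → Triple → Triple → Set
(a₁ , b₁ , c₁) ⊕³ (a₂ , b₂ , c₂) ≡ (a , b , c) =
  (a₁ ⊕ᴸ a₂ ≡ a) × (b₁ ⊕ᴸ b₂ ≡ b) × (c₁ ⊕ᴸ c₂ ≡ c)

_⊕ˢ_≡_ : SU → SU → SU → Set
u₁ ⊕ˢ u₂ ≡ u =
  Σ Kind λ i → InU i u₁ × InU i u₂ × InU i u ×
    (x u₁ ⊕³ x u₂ ≡ x u) × (y u₁ ⊕³ y u₂ ≡ y u)

_≥ˢ_ : SU → SU → Set
u ≥ˢ u' = Σ SU λ w → u' ⊕ˢ w ≡ u

HasOne : Triple → Set
HasOne (a , b , c) = (a ≡ 𝟙) ⊎ (b ≡ 𝟙) ⊎ (c ≡ 𝟙)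

AffineS : SU → Set
AffineS u = HasOne (x u) ⊎ HasOne (y u)

UniformS : SU → Set
UniformS u = x u ≡ y u

NeutralS : SU → Set
NeutralS u = Σ Kind λ i → InU i u × (∀ w → InU i w → (u ⊕ˢ w ≡ w))

AffinePresS : SU → Set
AffinePresS u = InU k3 u ⊎ InU k4 u ⊎ InU k5 u

record Names : Set₁ where
  field
    Var      : Set
    IsSignal : Var → Set
    TyName   : Set
    arity    : TyName → ℕ
    Con      : Set
    Fun      : Set

module Syntax (N : Names) where
  open Names N

  data Ty : Set where
    ind : (C : TyName) → IU → Vec Ty (arity C) → Ty
    set : IU → Ty → Ty
    sig : SU → Ty → Ty

  data IsKappa : Ty → Set
  data IsLambda : Ty → Set
  data IsSigma : Ty → Set

  data IsKappa where
    κ-ind : ∀ {C σs} → VAll.All IsKappa σs → IsKappa (ind C inf σs)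
    κ-set : ∀ {σ} → IsKappa σ → IsKappa (set inf σ)
    κ-sig : ∀ {u σ} → NeutralS u → IsKappa σ → IsKappa (sig u σ)

  data IsLambda where
    λ-ind  : ∀ {C σs} → VAll.All IsSigma σs → IsLambda (ind C one σs)
    λ-set  : ∀ {σ} → IsSigma σ → IsLambda (set one σ)
    λ-sigκ : ∀ {u σ} → AffineS u → UniformS u → IsKappa σ → IsLambda (sig u σ)
    λ-sigλ : ∀ {v σ} → AffinePresS v → UniformS v → IsLambda σ → IsLambda (sig v σ)

  data IsSigma where
    σ-κ : ∀ {τ} → IsKappa τ → IsSigma τ
    σ-λ : ∀ {τ} → IsLambda τ → IsSigma τ

  data IsRho : Ty → Set where
    ρ-σ    : ∀ {τ} → IsSigma τ → IsRho τ
    ρ-sigκ : ∀ {u σ} → IsKappa σ → IsRho (sig u σ)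
    ρ-sigλ : ∀ {v σ} → AffinePresS v → IsLambda σ → IsRho (sig v σ)

  data _⊕ᵀ_≡_ : Ty → Ty → Ty → Set where
    ⊕-ind : ∀ {C u₁ u₂ u σs} → u₁ ⊕ᴵ u₂ ≡ u → ind C u₁ σs ⊕ᵀ ind C u₂ σs ≡ ind C u σs
    ⊕-set : ∀ {u₁ u₂ u σ} → u₁ ⊕ᴵ u₂ ≡ u → set u₁ σ ⊕ᵀ set u₂ σ ≡ set u σ
    ⊕-sig : ∀ {u₁ u₂ u σ} → u₁ ⊕ˢ u₂ ≡ u → sig u₁ σ ⊕ᵀ sig u₂ σ ≡ sig u σ

  data Exp : Set where
    var : Var → Exp
    con : Con → List Exp → Exp
    fun : Fun → List Exp → Exp

  data IsValue : Exp → Set where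
    v-sig : ∀ {s} → IsSignal s → IsValue (var s)
    v-con : ∀ {c es} → LAll.All IsValue es → IsValue (con c es)

  data AllFV (P : Var → Set) : Exp → Set where
    fv-var : ∀ {x} → P x → AllFV P (var x)
    fv-con : ∀ {c es} → LAll.All (AllFV P) es → AllFV P (con c es)
    fv-fun : ∀ {f es} → LAll.All (AllFV P) es → AllFV P (fun f es)

  record Signature : Set₁ where
    field
      -- c has (an instance of its) declared type (σ₁,…,σₙ) → σ
      ConTy       : Con → List Ty → Ty → Set
      ConTy-σ     : ∀ {c σs σ} → ConTy c σs σ → LAll.All IsSigma σs × IsSigma σ
      funArgs     : Fun → List Ty
      funRes      : Fun → Ty
      funArgs-κ   : ∀ f → LAll.All IsKappa (funArgs f)
      funRes-κ    : ∀ f → IsKappa (funRes f)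
      FunEval     : Fun → List Exp → Exp → Set
      FunEval-val : ∀ {f vs v} → FunEval f vs v → LAll.All IsValue vs × IsValue v
      FunEval-det : ∀ {f vs v w} → FunEval f vs v → FunEval f vs w → v ≡ w

  module Typing (S : Signature) where
    open Signature S

    Ctx : Set
    Ctx = Var → Maybe Ty

    Finite : Ctx → Set
    Finite Γ = Σ (List Var) λ xs → ∀ x τ → Γ x ≡ just τ → x ∈ xs

    WfCtx : Ctx → Set
    WfCtx Γ = Finite Γ × (∀ x τ → Γ x ≡ just τ → IsRho τ)

    data MaybeSum : Maybe Ty → Maybe Ty → Maybe Ty → Set where
      nn : MaybeSum nothing nothing nothing
      jn : ∀ {τ} → MaybeSum (just τ) nothing (just τ)
      nj : ∀ {τ} → MaybeSum nothing (just τ) (just τ)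
      jj : ∀ {τ₁ τ₂ τ} → τ₁ ⊕ᵀ τ₂ ≡ τ → MaybeSum (just τ₁) (just τ₂) (just τ)

    _⊕ᶜ_≡_ : Ctx → Ctx → Ctx → Set
    Γ₁ ⊕ᶜ Γ₂ ≡ Γ = ∀ x → MaybeSum (Γ₁ x) (Γ₂ x) (Γ x)

    data Sum : Ctx → List Ctx → Ctx → Set where
      sum-[] : ∀ {Γ} → Sum Γ [] Γ
      sum-∷  : ∀ {Γ₀ Γ₁ Δ Γs Γ} → Γ₀ ⊕ᶜ Γ₁ ≡ Δ → Sum Δ Γs Γ → Sum Γ₀ (Γ₁ ∷ Γs) Γ

    data _⊢_∶_ : Ctx → Exp → Ty → Set
    data _⊢*_∶_ : List Ctx → List Exp → List Ty → Set

    data _⊢_∶_ where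
      var-ind : ∀ {Γ x C u u' σs} → Γ x ≡ just (ind C u σs) → u ≥ᴵ u' →
                Γ ⊢ var x ∶ ind C u' σs
      var-set : ∀ {Γ x u u' σ} → Γ x ≡ just (set u σ) → u ≥ᴵ u' →
                Γ ⊢ var x ∶ set u' σ
      var-sig : ∀ {Γ x u u' σ} → Γ x ≡ just (sig u σ) → u ≥ˢ u' →
                Γ ⊢ var x ∶ sig u' σ
      k-con   : ∀ {Γ₀ Γs Γ c es σs σ} → ConTy c σs σ → Γs ⊢* es ∶ σs →
                Sum Γ₀ Γs Γ → Γ ⊢ con c es ∶ σ
      k-fun   : ∀ {Γ₀ Γs Γ f es} → Γs ⊢* es ∶ funArgs f →
                Sum Γ₀ Γs Γ → Γ ⊢ fun f es ∶ funRes f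

    data _⊢*_∶_ where
      []  : [] ⊢* [] ∶ []
      _∷_ : ∀ {Γ e σ Γs es σs} → Γ ⊢ e ∶ σ → Γs ⊢* es ∶ σs →
            (Γ ∷ Γs) ⊢* (e ∷ es) ∶ (σ ∷ σs)

    data _⇓_ : Exp → Exp → Set
    data _⇓*_ : List Exp → List Exp → Set

    data _⇓_ where
      ⇓-val : ∀ {v} → IsValue v → v ⇓ v
      ⇓-con : ∀ {c es vs} → es ⇓* vs → con c es ⇓ con c vs
      ⇓-fun : ∀ {f es vs v} → es ⇓* vs → FunEval f vs v → fun f es ⇓ v

    data _⇓*_ where
      []  : [] ⇓* []
      _∷_ : ∀ {e v es vs} → e ⇓ v → es ⇓* vs → (e ∷ es) ⇓* (v ∷ vs)

    StandingAssumption : Set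
    StandingAssumption =
      ∀ (Γ : Ctx) → WfCtx Γ → ∀ f vs v →
        LAll.All IsValue vs → Γ ⊢ fun f vs ∶ funRes f → fun f vs ⇓ v → Γ ⊢ v ∶ funRes f

module Submission where

-- For a function call f(e₁,…,eₙ) ⇓ v we first
-- type the argument values v₁,…,vₙ by induction and then invoke the standing
-- assumption on f(v₁,…,vₙ) ⇓ v.  The standing assumption, however, is only
-- available in well-formed contexts, while the arguments eᵢ are typed in the
-- summands Γᵢ of Γ = Γ₀ ⊕ Γ₁ ⊕ ⋯ ⊕ Γₙ.  The bulk of the file therefore shows
-- that the summands of a well-formed context are well-formed:
--   * usages: the only defined sum of inductive/set usages is ∞ ⊕ ∞ = ∞, and
--     the summands of an affine-preserving signal usage are affine-preserving;
--   * types: the summands of a type of shape ρ have shape ρ;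
--   * contexts: every summand Γᵢ of Γ is a "sub-context" Γᵢ ≼ Γ, and
--     sub-contexts of well-formed contexts are well-formed.

open import Defs
open import Data.Product using (Σ; _×_; _,_; proj₁; proj₂)
open import Data.Sum using (_⊎_; inj₁; inj₂)
open import Data.Maybe using (just)
import Data.List.Relation.Unary.All as LAll
open import Relation.Binary.PropositionalEquality using (_≡_; refl)

data IsAffinePresKind : Kind → Set where
  ap3 : IsAffinePresKind k3
  ap4 : IsAffinePresKind k4
  ap5 : IsAffinePresKind k5

-- A triple of an affine-preserving kind belongs to no other kind, except
-- possibly another affine-preserving one (e.g. (0,0,0) lies in kinds 4 and 5).
affinePresKind-unique : ∀ {i j t} → InKind i t → InKind j t →
                        IsAffinePresKind j → IsAffinePresKind i
affinePresKind-unique e1    e1    ()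
affinePresKind-unique e2    e2    ()
affinePresKind-unique e2-d  e2-d  ()
affinePresKind-unique e3    _ _ = ap3
affinePresKind-unique e3-d  _ _ = ap3
affinePresKind-unique e4    _ _ = ap4
affinePresKind-unique e4-d1 _ _ = ap4
affinePresKind-unique e4-d2 _ _ = ap4
affinePresKind-unique e4-d3 _ _ = ap4
affinePresKind-unique e5    _ _ = ap5
affinePresKind-unique e5-d1 _ _ = ap5
affinePresKind-unique e5-d2 _ _ = ap5
affinePresKind-unique e5-d3 _ _ = ap5

affinePres-kind : ∀ {u} → AffinePresS u → Σ Kind λ j → InU j u × IsAffinePresKind j
affinePres-kind (inj₁ p)        = k3 , p , ap3
affinePres-kind (inj₂ (inj₁ p)) = k4 , p , ap4
affinePres-kind (inj₂ (inj₂ p)) = k5 , p , ap5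

kind-affinePres : ∀ {i u} → InU i u → IsAffinePresKind i → AffinePresS u
kind-affinePres p ap3 = inj₁ p
kind-affinePres p ap4 = inj₂ (inj₁ p)
kind-affinePres p ap5 = inj₂ (inj₂ p)

-- The summands of an affine-preserving signal usage are affine-preserving:
-- a sum is taken inside one U(i), and that i must be affine-preserving.
⊕ˢ-affinePres : ∀ {u₁ u₂ u} → u₁ ⊕ˢ u₂ ≡ u → AffinePresS u →
                AffinePresS u₁ × AffinePresS u₂
⊕ˢ-affinePres (i , p₁ , p₂ , (px , _) , _) apu =
  let (j , (qx , _) , apj) = affinePres-kind apu
      api = affinePresKind-unique px qx apj
  in  kind-affinePres p₁ api , kind-affinePres p₂ api

-- Inductive and set usages never contain 0, so the only defined sum among
-- them is ∞ ⊕ ∞ = ∞: both summands equal the sum.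
⊕ᴵ-summands : ∀ {u₁ u₂ u} → u₁ ⊕ᴵ u₂ ≡ u → (u₁ ≡ u) × (u₂ ≡ u)
⊕ᴵ-summands {one} {one} ()
⊕ᴵ-summands {one} {inf} ()
⊕ᴵ-summands {inf} {one} ()
⊕ᴵ-summands {inf} {inf} {one} ()
⊕ᴵ-summands {inf} {inf} {inf} _ = refl , refl

module Preservation (N : Names) (S : Syntax.Signature N) where
  open Names N
  open Syntax N
  open Typing S
  open Signature S

  sig-shape : ∀ {u σ} → IsRho (sig u σ) → IsKappa σ ⊎ (AffinePresS u × IsLambda σ)
  sig-shape (ρ-σ (σ-κ (κ-sig _ k)))      = inj₁ k
  sig-shape (ρ-σ (σ-λ (λ-sigκ _ _ k)))   = inj₁ k
  sig-shape (ρ-σ (σ-λ (λ-sigλ ap _ l)))  = inj₂ (ap , l)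
  sig-shape (ρ-sigκ k)                   = inj₁ k
  sig-shape (ρ-sigλ ap l)                = inj₂ (ap , l)

  ⊕ᵀ-rho : ∀ {τ₁ τ₂ τ} → τ₁ ⊕ᵀ τ₂ ≡ τ → IsRho τ → IsRho τ₁ × IsRho τ₂
  ⊕ᵀ-rho (⊕-ind p) r with ⊕ᴵ-summands p
  ... | refl , refl = r , r
  ⊕ᵀ-rho (⊕-set p) r with ⊕ᴵ-summands p
  ... | refl , refl = r , r
  ⊕ᵀ-rho (⊕-sig p) r with sig-shape r
  ... | inj₁ k = ρ-sigκ k , ρ-sigκ k
  ... | inj₂ (ap , l) = let (ap₁ , ap₂) = ⊕ˢ-affinePres p ap in ρ-sigλ ap₁ l , ρ-sigλ ap₂ l

  _≼_ : Ctx → Ctx → Set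
  Γ ≼ Δ = ∀ x τ → Γ x ≡ just τ →
          Σ Ty λ τ' → (Δ x ≡ just τ') × (IsRho τ' → IsRho τ)

  ≼-trans : ∀ {Γ Δ Θ} → Γ ≼ Δ → Δ ≼ Θ → Γ ≼ Θ
  ≼-trans Γ≼Δ Δ≼Θ x τ eq =
    let (τ' , eq' , r') = Γ≼Δ x τ eq
        (τ'' , eq'' , r'') = Δ≼Θ x τ' eq'
    in  τ'' , eq'' , λ r → r' (r'' r)

  ≼-wf : ∀ {Γ Δ} → Γ ≼ Δ → WfCtx Δ → WfCtx Γ
  ≼-wf Γ≼Δ ((xs , finite) , admissible) =
      (xs , λ x τ eq → let (τ' , eq' , _) = Γ≼Δ x τ eq in finite x τ' eq')
    , (λ x τ eq → let (τ' , eq' , r) = Γ≼Δ x τ eq in r (admissible x τ' eq'))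

  MaybeSum-ˡ : ∀ {m₁ m₂ m τ} → MaybeSum m₁ m₂ m → m₁ ≡ just τ →
               Σ Ty λ τ' → (m ≡ just τ') × (IsRho τ' → IsRho τ)
  MaybeSum-ˡ jn     refl = _ , refl , λ r → r
  MaybeSum-ˡ (jj p) refl = _ , refl , λ r → proj₁ (⊕ᵀ-rho p r)

  MaybeSum-ʳ : ∀ {m₁ m₂ m τ} → MaybeSum m₁ m₂ m → m₂ ≡ just τ →
               Σ Ty λ τ' → (m ≡ just τ') × (IsRho τ' → IsRho τ)
  MaybeSum-ʳ nj     refl = _ , refl , λ r → r
  MaybeSum-ʳ (jj p) refl = _ , refl , λ r → proj₂ (⊕ᵀ-rho p r)

  ⊕ᶜ-≼ˡ : ∀ {Γ₁ Γ₂ Δ} → Γ₁ ⊕ᶜ Γ₂ ≡ Δ → Γ₁ ≼ Δ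
  ⊕ᶜ-≼ˡ s x τ = MaybeSum-ˡ (s x)

  ⊕ᶜ-≼ʳ : ∀ {Γ₁ Γ₂ Δ} → Γ₁ ⊕ᶜ Γ₂ ≡ Δ → Γ₂ ≼ Δ
  ⊕ᶜ-≼ʳ s x τ = MaybeSum-ʳ (s x)

  Sum-≼₀ : ∀ {Γ₀ Γs Γ} → Sum Γ₀ Γs Γ → Γ₀ ≼ Γ
  Sum-≼₀ sum-[]       x τ eq = τ , eq , λ r → r
  Sum-≼₀ (sum-∷ s ss) = ≼-trans (⊕ᶜ-≼ˡ s) (Sum-≼₀ ss)

  Sum-≼ : ∀ {Γ₀ Γs Γ} → Sum Γ₀ Γs Γ → LAll.All (_≼ Γ) Γs
  Sum-≼ sum-[]       = LAll.[]
  Sum-≼ (sum-∷ s ss) = ≼-trans (⊕ᶜ-≼ʳ s) (Sum-≼₀ ss) LAll.∷ Sum-≼ ss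

  Sum-wf : ∀ {Γ₀ Γs Γ} → Sum Γ₀ Γs Γ → WfCtx Γ → LAll.All WfCtx Γs
  Sum-wf s w = LAll.map (λ Γᵢ≼Γ → ≼-wf Γᵢ≼Γ w) (Sum-≼ s)

  values⇓ : ∀ {vs} → LAll.All IsValue vs → vs ⇓* vs
  values⇓ LAll.[]       = []
  values⇓ (p LAll.∷ ps) = ⇓-val p ∷ values⇓ ps

  module _ (standing : StandingAssumption) where
    preservation  : ∀ {Γ e ρ v} → WfCtx Γ → Γ ⊢ e ∶ ρ → e ⇓ v → Γ ⊢ v ∶ ρ
    preservation* : ∀ {Γs es σs vs} → LAll.All WfCtx Γs →
                    Γs ⊢* es ∶ σs → es ⇓* vs → Γs ⊢* vs ∶ σs

    preservation w t (⇓-val _) = t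
    preservation w (k-con c ts s) (⇓-con ev) =
      k-con c (preservation* (Sum-wf s w) ts ev) s
    preservation {Γ} w (k-fun ts s) (⇓-fun {f = f} {vs = vs} {v = v} ev fe) =
      let values = proj₁ (FunEval-val fe)
          typedCall = k-fun (preservation* (Sum-wf s w) ts ev) s
      in  standing Γ w f vs v values typedCall (⇓-fun (values⇓ values) fe)

    preservation* LAll.[]       []       []       = []
    preservation* (w LAll.∷ ws) (t ∷ ts) (e ∷ es) =
      preservation w t e ∷ preservation* ws ts es

lemma3 : (N : Names) (S : Syntax.Signature N) →
    let open Names N
        open Syntax N
        open Typing S
    in StandingAssumption →
       ∀ (Γ : Ctx) (e : Exp) (ρ : Ty) (v : Exp) →
       WfCtx Γ → IsRho ρ → AllFV IsSignal e → IsValue v →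
       Γ ⊢ e ∶ ρ → e ⇓ v → Γ ⊢ v ∶ ρ
lemma3 N S standing Γ e ρ v wf _ _ _ typed eval =
  Preservation.preservation N S standing wf typed eval
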